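{- Let $T=(V,E)$ be a tree with $n$ vertices, given with a tree ordering $v_1,\dots,v_n$. The algorithm INDEPENDENT-ROMAN $\{2\}$-DOM-IN-TREE described below outputs $i_{\{R2\}}(T)$, and it runs in time $O(n)$. Algorithm: If $T=K_1$, return $1$. Otherwise, for each $i=1,\dots,n$ initialize the vector $l[i,1..5]=(2,1,\infty,\infty,0)$. Then for $j=1,\dots,n-1$ (in increasing order), let $v_k=F(v_j)$ and perform, in this order, the updates $l[k,1]=\min\{l[k,1]+l[j,3],\ l[k,1]+l[j,4],\ l[k,1]+l[j,5]\}$; $l[k,2]=\min\{l[k,2]+l[j,3],\ l[k,2]+l[j,4]\}$; $l[k,3]=\min\{l[k,3]+l[j,1],\ l[k,3]+l[j,2],\ l[k,3]+l[j,3],\ l[k,4]+l[j,1],\ l[k,4]+l[j,2],\ l[k,5]+l[j,1]\}$; $l[k,4]=\min\{l[k,4]+l[j,3],\ l[k,5]+l[j,2]\}$; $l[k,5]=l[k,5]+l[j,3]$. Finally return $\min\{l[n,1],l[n,2],l[n,3]\}$. (Here $\infty$ denotes "undefined", with $\infty+x=\infty$.)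
   Context: For a graph $G=(V,E)$, a Roman $\{2\}$-dominating function (R2DF) is a function $f:V\to\{0,1,2\}$ such that every vertex $v$ with $f(v)=0$ satisfies $\sum_{u\in N(v)} f(u)\ge 2$. It is an independent Roman $\{2\}$-dominating function (IR2DF) if moreover the set $\{v: f(v)>0\}$ is an independent set. The weight of $f$ is $\sum_{v\in V}f(v)$, and $i_{\{R2\}}(G)$ is the minimum weight of an IR2DF of $G$. A tree ordering of a tree $T$ on $n$ vertices is an ordering $v_1,\dots,v_n$ of its vertices such that for each $1\le i\le n-1$, $v_i$ has exactly one neighbor $v_j$ with $j>i$; this neighbor is called the father of $v_i$ and denoted $F(v_i)$. -}

module Defs where

open import Data.Nat using (ℕ; zero; suc; _+_; _*_; _≤_; _<_; _⊓_)
open import Data.Fin using (Fin; toℕ; inject₁; fromℕ; _≟_)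
open import Data.Bool using (Bool; true; false; if_then_else_)
open import Data.Maybe using (Maybe; just; nothing)
open import Data.List using (List; []; _∷_; foldl; length; tabulate; last)
open import Data.List.Relation.Unary.Linked using (Linked)
open import Data.List.Relation.Unary.Unique.Propositional using (Unique)
open import Data.Product using (Σ; _×_; _,_; ∃; proj₁; proj₂)
open import Data.Empty using (⊥)
open import Relation.Nullary using (¬_; yes; no)
open import Relation.Binary.PropositionalEquality using (_≡_)
open import Function.Definitions using (Injective)

record Graph (n : ℕ) : Set where
  field
    Adj   : Fin n → Fin n → Bool
    sym   : ∀ u v → Adj u v ≡ Adj v u
    irrefl : ∀ v → Adj v v ≡ false
open Graph public

Adjacent : ∀ {n} → Graph n → Fin n → Fin n → Set
Adjacent G u v = Adj G u v ≡ true

data Reach {n} (G : Graph n) (u : Fin n) : Fin n → Set where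
  here  : Reach G u u
  there : ∀ {v w} → Reach G u v → Adjacent G v w → Reach G u w

Connected : ∀ {n} → Graph n → Set
Connected G = ∀ u v → Reach G u v

IsCycle : ∀ {n} → Graph n → List (Fin n) → Set
IsCycle G []       = ⊥
IsCycle G (x ∷ xs) =
  3 ≤ length (x ∷ xs) × Unique (x ∷ xs) × Linked (Adjacent G) (x ∷ xs)
  × Adjacent G (Data.Maybe.fromMaybe x (last (x ∷ xs))) x

Acyclic : ∀ {n} → Graph n → Set
Acyclic G = ∀ xs → ¬ IsCycle G xs

-- a tree (nonempty vertex set is imposed where used: n = suc m)
IsTree : ∀ {n} → Graph n → Set
IsTree G = Connected G × Acyclic G

-- Tree orderings.  An ordering v_1..v_n of the vertices is an injective
-- (hence bijective) map  ord : Fin n → Fin n  (position ↦ vertex);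
-- position i (0-based) corresponds to v_{i+1}.

IsTreeOrdering : ∀ {m} → Graph (suc m) → (Fin (suc m) → Fin (suc m)) → Set
IsTreeOrdering {m} G ord =
  Injective _≡_ _≡_ ord ×
  (∀ (i : Fin (suc m)) → toℕ i < m →
     Σ (Fin (suc m)) λ j → (toℕ i < toℕ j × Adjacent G (ord i) (ord j))
       × (∀ k → toℕ i < toℕ k → Adjacent G (ord i) (ord k) → k ≡ j))

-- fa is the father map (on positions): for each non-last position i,
-- fa i is the position of F(v_i).  (Its value at the last position is
-- irrelevant.)
IsFatherMap : ∀ {m} → Graph (suc m) → (Fin (suc m) → Fin (suc m))
              → (Fin (suc m) → Fin (suc m)) → Set
IsFatherMap {m} G ord fa =
  ∀ (i : Fin (suc m)) → toℕ i < m →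
    toℕ i < toℕ (fa i) × Adjacent G (ord i) (ord (fa i))

sumF : ∀ {n} → (Fin n → ℕ) → ℕ
sumF {zero}  f = 0
sumF {suc n} f = f Data.Fin.zero + sumF (λ i → f (Data.Fin.suc i))

weight : ∀ {n} → (Fin n → ℕ) → ℕ
weight = sumF

nbrSum : ∀ {n} → Graph n → (Fin n → ℕ) → Fin n → ℕ
nbrSum G f v = sumF (λ u → if Adj G v u then f u else 0)

IsR2DF : ∀ {n} → Graph n → (Fin n → ℕ) → Set
IsR2DF G f = (∀ v → f v ≤ 2) × (∀ v → f v ≡ 0 → 2 ≤ nbrSum G f v)

IsIR2DF : ∀ {n} → Graph n → (Fin n → ℕ) → Set
IsIR2DF G f = IsR2DF G f ×
  (∀ u v → Adjacent G u v → 0 < f u → 0 < f v → ⊥)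

IsIndepRoman2DomNumber : ∀ {n} → Graph n → ℕ → Set
IsIndepRoman2DomNumber G r =
  (Σ _ λ f → IsIR2DF G f × weight f ≡ r)
  × (∀ f → IsIR2DF G f → r ≤ weight f)

ℕ∞ : Set
ℕ∞ = Maybe ℕ

∞ : ℕ∞
∞ = nothing

_⊕_ : ℕ∞ → ℕ∞ → ℕ∞
just a ⊕ just b = just (a + b)
_      ⊕ _      = nothing

min∞ : ℕ∞ → ℕ∞ → ℕ∞
min∞ nothing  y        = y
min∞ (just a) nothing  = just a
min∞ (just a) (just b) = just (a ⊓ b)

record Row : Set where
  constructor row
  field l1 l2 l3 l4 l5 : ℕ∞
open Row public

initRow : Row
initRow = row (just 2) (just 1) ∞ ∞ (just 0)

-- the five updates l[k,·] given the row of v_k and the row of v_j,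
-- performed in the stated order (each update only reads entries
-- of row k not yet updated, and row j)
updateRow : Row → Row → Row
updateRow K J =
  row (min∞ (l1 K ⊕ l3 J) (min∞ (l1 K ⊕ l4 J) (l1 K ⊕ l5 J)))
      (min∞ (l2 K ⊕ l3 J) (l2 K ⊕ l4 J))
      (min∞ (l3 K ⊕ l1 J) (min∞ (l3 K ⊕ l2 J) (min∞ (l3 K ⊕ l3 J)
        (min∞ (l4 K ⊕ l1 J) (min∞ (l4 K ⊕ l2 J) (l5 K ⊕ l1 J))))))
      (min∞ (l4 K ⊕ l3 J) (l5 K ⊕ l2 J))
      (l5 K ⊕ l3 J)

Table : ℕ → Set
Table n = Fin n → Row

-- state of the algorithm: the table and a counter of elementary steps
State : ℕ → Set
State n = Table n × ℕ

-- one iteration j of the main loop (k = fa j); costs a constant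
-- number (7) of elementary steps: 1 father lookup, 1 read of row j,
-- 5 updates of row k
step : ∀ {n} → (Fin n → Fin n) → State n → Fin n → State n
step {n} fa (l , c) j = upd , c + 7
  where
    k : Fin n
    k = fa j
    upd : Fin n → Row
    upd i with i ≟ k
    ... | yes _ = updateRow (l k) (l j)
    ... | no  _ = l i

-- Input: n = suc m vertices (given
-- through the positions of the tree ordering) and the father map fa on
-- positions.
-- Initialisation costs 5 steps per vertex; the loop runs over
-- j = 1 .. n-1 (positions 0 .. m-1) in increasing order; the final
-- minimum costs 3 steps.
algorithm : ∀ {m} → (Fin (suc m) → Fin (suc m)) → ℕ∞ × ℕ
algorithm {zero}  fa = just 1 , 1
algorithm {suc m} fa =
  let (l , c) = foldl (step fa) ((λ _ → initRow) , 5 * suc (suc m))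
                      (tabulate {n = suc m} inject₁)
      L = l (fromℕ (suc m))
  in min∞ (l1 L) (min∞ (l2 L) (l3 L)) , c + 3

-- After the first j iterations, the edges v_i F(v_i) with i ≤ j form a forest whose
-- roots are v_{j+1}, …, v_n.  Give each vertex a status: its value is 2 or 1, or it is 0
-- and its neighbours in the forest carry total value ≥ 2, 1 or 0.  The invariant is that
-- l[i,t] is the least weight, on the component of the root v_i, of a function that is an
-- independent Roman {2}-dominating function except possibly at v_i and gives v_i status t.
-- Attaching v_j below v_k = F(v_j) determines the new status of v_k from the old statuses
-- of v_k and v_j by a fixed table (which also rules out the combinations leaving v_j
-- undominated or the edge not independent); the five updates take the minimum over exactly
-- this table, so the invariant is preserved.  At the end v_n is the only root, and the
-- IR2DFs of the forest are the functions giving v_n one of the first three statuses.  In a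
-- tree ordering the edges of T are exactly the pairs v_i F(v_i), so that forest is T,
-- relabelled along the ordering.  Each iteration costs a constant number of steps.

module Submission where

open import Defs hiding (sym)
open import Algebra.Bundles using (CommutativeMonoid)
import Algebra.Properties.CommutativeMonoid.Sum as MonoidSum
open import Data.Bool using (Bool; true; false; if_then_else_; _∧_; _∨_)
open import Data.Bool.Properties using (∨-comm; ∨-zeroʳ; ∧-zeroʳ; ∧-identityʳ)
open import Data.Empty using (⊥; ⊥-elim)
open import Data.Fin as Fin using (Fin; toℕ; inject₁; fromℕ; _≟_; punchIn; punchOut)
open import Data.Fin.Properties
  using (toℕ-injective; punchInᵢ≢i; toℕ≤pred[n]; toℕ-fromℕ; toℕ-inject₁; any?; injective⇒≤; punchOut-injective)
open import Data.Fin.Permutation as Perm using (Permutation; _⟨$⟩ʳ_; _⟨$⟩ˡ_; inverseˡ; inverseʳ)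
open import Data.List using (List; []; _∷_; foldl; tabulate; length)
open import Data.List.Properties using (length-tabulate)
open import Data.List.NonEmpty using (List⁺; _∷_; toList)
open import Data.List.Membership.Propositional using (_∈_)
open import Data.List.Relation.Unary.Any using (here; there)
open import Data.Maybe using (Maybe; just; nothing)
open import Data.Maybe.Properties using (just-injective)
open import Data.Nat using (ℕ; zero; suc; _+_; _*_; _≤_; _<_; z≤n; s≤s; _<?_; _≤?_)
import Data.Nat.Properties as ℕ
open import Data.Product using (Σ; ∃; _×_; _,_; proj₁; proj₂)
open import Data.Sum using (_⊎_; inj₁; inj₂)
open import Data.Unit using (⊤; tt)
open import Function using (_∘_)
open import Function.Definitions using (Injective)
open import Relation.Nullary using (¬_; Dec; yes; no; does)
open import Relation.Nullary.Decidable using (dec-true; dec-false; toSum)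
open import Relation.Binary.Definitions using (tri<; tri≈; tri>)
open import Relation.Binary.PropositionalEquality
  using (_≡_; _≢_; refl; sym; trans; cong; cong₂; subst; subst₂; isEquivalence; module ≡-Reasoning)

∧-true⁻¹ : ∀ {x y} → x ∧ y ≡ true → x ≡ true × y ≡ true
∧-true⁻¹ {true} {true} _ = refl , refl

does⇒ : ∀ {A : Set} (a? : Dec A) → does a? ≡ true → A
does⇒ (yes a) _ = a

does-cong : ∀ {A B : Set} (a? : Dec A) (b? : Dec B) → (A → B) → (B → A) → does a? ≡ does b?
does-cong (yes a) b? A→B _   = sym (dec-true b? (A→B a))
does-cong (no ¬a) b? _   B→A = sym (dec-false b? (¬a ∘ B→A))

Bool-≡ : ∀ {x y} → (x ≡ true → y ≡ true) → (y ≡ true → x ≡ true) → x ≡ y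
Bool-≡ {false} {false} _ _ = refl
Bool-≡ {false} {true}  _ y⇒x = y⇒x refl
Bool-≡ {true}        x⇒y _   = sym (x⇒y refl)

-- Extended naturals

infix 4 _≼_

_≼_ : ℕ∞ → ℕ∞ → Set
_      ≼ nothing = ⊤
nothing ≼ just _ = ⊥
just a ≼ just b = a ≤ b

Finite : ℕ∞ → Set
Finite x = ∃ λ c → x ≡ just c

≼-refl : ∀ x → x ≼ x
≼-refl nothing  = tt
≼-refl (just a) = ℕ.≤-refl

≼-trans : ∀ {x y z} → x ≼ y → y ≼ z → x ≼ z
≼-trans {z = nothing} _ _ = tt
≼-trans {just a} {just b} {just c} p q = ℕ.≤-trans p q

≼-finite : ∀ {x y} → x ≼ y → Finite y → Finite x
≼-finite {just a} _  _          = a , refl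
≼-finite {nothing} () (_ , refl)

min∞-≼ˡ : ∀ x y → min∞ x y ≼ x
min∞-≼ˡ nothing  y        = tt
min∞-≼ˡ (just a) nothing  = ℕ.≤-refl
min∞-≼ˡ (just a) (just b) = ℕ.m⊓n≤m a b

min∞-≼ʳ : ∀ x y → min∞ x y ≼ y
min∞-≼ʳ nothing  y        = ≼-refl y
min∞-≼ʳ (just a) nothing  = tt
min∞-≼ʳ (just a) (just b) = ℕ.m⊓n≤n a b

min∞-sel : ∀ x y {c} → min∞ x y ≡ just c → x ≡ just c ⊎ y ≡ just c
min∞-sel nothing  y        e = inj₂ e
min∞-sel (just a) nothing  e = inj₁ e
min∞-sel (just a) (just b) e with ℕ.⊓-sel a b
... | inj₁ p = inj₁ (trans (cong just (sym p)) e)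
... | inj₂ p = inj₂ (trans (cong just (sym p)) e)

⊕-mono-≼ : ∀ {x y u v} → x ≼ y → u ≼ v → x ⊕ u ≼ y ⊕ v
⊕-mono-≼ {y = nothing}                 _ _ = tt
⊕-mono-≼ {y = just _} {v = nothing}    _ _ = tt
⊕-mono-≼ {just _} {just _} {just _} {just _} p q = ℕ.+-mono-≤ p q

⊕-finite : ∀ {x y} → Finite x → Finite y → Finite (x ⊕ y)
⊕-finite (a , refl) (b , refl) = a + b , refl

⊕-just⁻¹ : ∀ x y {c} → x ⊕ y ≡ just c →
           ∃ λ a → ∃ λ b → x ≡ just a × y ≡ just b × a + b ≡ c
⊕-just⁻¹ (just a) (just b) refl = a , b , refl , refl , refl

⊕-identityˡ : ∀ x → just 0 ⊕ x ≡ x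
⊕-identityˡ nothing  = refl
⊕-identityˡ (just a) = refl

⊕-identityʳ : ∀ x → x ⊕ just 0 ≡ x
⊕-identityʳ nothing  = refl
⊕-identityʳ (just a) = cong just (ℕ.+-identityʳ a)

⊕-comm : ∀ x y → x ⊕ y ≡ y ⊕ x
⊕-comm nothing  nothing  = refl
⊕-comm nothing  (just b) = refl
⊕-comm (just a) nothing  = refl
⊕-comm (just a) (just b) = cong just (ℕ.+-comm a b)

⊕-assoc : ∀ x y z → (x ⊕ y) ⊕ z ≡ x ⊕ (y ⊕ z)
⊕-assoc nothing  y        z        = refl
⊕-assoc (just a) nothing  z        = refl
⊕-assoc (just a) (just b) nothing  = refl
⊕-assoc (just a) (just b) (just c) = cong just (ℕ.+-assoc a b c)

⊕-commutativeMonoid : CommutativeMonoid _ _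
⊕-commutativeMonoid = record
  { Carrier = ℕ∞ ; _≈_ = _≡_ ; _∙_ = _⊕_ ; ε = just 0
  ; isCommutativeMonoid = record
    { isMonoid = record
      { isSemigroup = record
        { isMagma = record { isEquivalence = isEquivalence
                           ; ∙-cong = cong₂ _⊕_ }
        ; assoc = ⊕-assoc }
      ; identity = ⊕-identityˡ , ⊕-identityʳ }
    ; comm = ⊕-comm } }

minOver : ∀ {A : Set} → (A → ℕ∞) → A → List A → ℕ∞
minOver h x []       = h x
minOver h x (y ∷ ys) = min∞ (h x) (minOver h y ys)

⨅ : ∀ {A : Set} → (A → ℕ∞) → List⁺ A → ℕ∞
⨅ h (x ∷ xs) = minOver h x xs

minOver-≼ : ∀ {A : Set} (h : A → ℕ∞) x xs {y} → y ∈ x ∷ xs → minOver h x xs ≼ h y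
minOver-≼ h x []       (here refl)  = ≼-refl (h x)
minOver-≼ h x (y ∷ ys) (here refl)  = min∞-≼ˡ (h x) _
minOver-≼ h x (y ∷ ys) (there y∈ys) = ≼-trans (min∞-≼ʳ (h x) _) (minOver-≼ h y ys y∈ys)

minOver-attained : ∀ {A : Set} (h : A → ℕ∞) x xs {c} → minOver h x xs ≡ just c →
                   ∃ λ y → y ∈ x ∷ xs × h y ≡ just c
minOver-attained h x []       e = x , here refl , e
minOver-attained h x (y ∷ ys) e with min∞-sel (h x) _ e
... | inj₁ hx = x , here refl , hx
... | inj₂ rest with minOver-attained h y ys rest
... | z , z∈ , hz = z , there z∈ , hz

⨅-≼ : ∀ {A : Set} (h : A → ℕ∞) (xs : List⁺ A) {y} → y ∈ toList xs → ⨅ h xs ≼ h y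
⨅-≼ h (x ∷ xs) = minOver-≼ h x xs

⨅-attained : ∀ {A : Set} (h : A → ℕ∞) (xs : List⁺ A) {c} → ⨅ h xs ≡ just c →
             ∃ λ y → y ∈ toList xs × h y ≡ just c
⨅-attained h (x ∷ xs) = minOver-attained h x xs

-- Finite sums

module _ {a ℓ} (M : CommutativeMonoid a ℓ) where
  open CommutativeMonoid M
    using (Carrier; _≈_; _∙_; ε; ∙-congˡ; ∙-congʳ; identityˡ; setoid)
    renaming (sym to ≈-sym)
  open MonoidSum M using (sum; sum-remove; sum-cong-≋)
  open import Relation.Binary.Reasoning.Setoid setoid

  sum-point : ∀ {n} (g h : Fin (suc n) → Carrier) p →
              (∀ u → u ≢ p → g u ≈ h u) → h p ≈ ε → sum g ≈ g p ∙ sum h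
  sum-point g h p g≈h hp≈ε = begin
    sum g                              ≈⟨ sum-remove {i = p} g ⟩
    g p ∙ sum (g ∘ punchIn p)          ≈⟨ ∙-congˡ (sum-cong-≋ λ i → g≈h _ (punchInᵢ≢i p i)) ⟩
    g p ∙ sum (h ∘ punchIn p)          ≈⟨ ∙-congˡ (≈-sym (identityˡ _)) ⟩
    g p ∙ (ε ∙ sum (h ∘ punchIn p))    ≈⟨ ∙-congˡ (∙-congʳ (≈-sym hp≈ε)) ⟩
    g p ∙ (h p ∙ sum (h ∘ punchIn p))  ≈⟨ ∙-congˡ (≈-sym (sum-remove {i = p} h)) ⟩
    g p ∙ sum h                        ∎

module ℕΣ = MonoidSum ℕ.+-0-commutativeMonoid
module ℕ∞Σ = MonoidSum ⊕-commutativeMonoid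

sumF≡sum : ∀ {n} (h : Fin n → ℕ) → sumF h ≡ ℕΣ.sum h
sumF≡sum {zero}  h = refl
sumF≡sum {suc n} h = cong (h Fin.zero +_) (sumF≡sum (h ∘ Fin.suc))

sumF-cong : ∀ {n} {g h : Fin n → ℕ} → (∀ u → g u ≡ h u) → sumF g ≡ sumF h
sumF-cong {g = g} {h} g≗h = trans (sumF≡sum g) (trans (ℕΣ.sum-cong-≗ g≗h) (sym (sumF≡sum h)))

sumF-zero : ∀ {n} {g : Fin n → ℕ} → (∀ u → g u ≡ 0) → sumF g ≡ 0
sumF-zero {zero}  _   = refl
sumF-zero {suc n} g≡0 = cong₂ _+_ (g≡0 Fin.zero) (sumF-zero (g≡0 ∘ Fin.suc))

sumF-point : ∀ {n} (g h : Fin (suc n) → ℕ) p →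
             (∀ u → u ≢ p → g u ≡ h u) → h p ≡ 0 → sumF g ≡ g p + sumF h
sumF-point g h p g≗h hp = begin
  sumF g          ≡⟨ sumF≡sum g ⟩
  ℕΣ.sum g        ≡⟨ sum-point ℕ.+-0-commutativeMonoid g h p g≗h hp ⟩
  g p + ℕΣ.sum h  ≡⟨ cong (g p +_) (sym (sumF≡sum h)) ⟩
  g p + sumF h    ∎
  where open ≡-Reasoning

sum∞ : ∀ {n} → (Fin n → ℕ∞) → ℕ∞
sum∞ = ℕ∞Σ.sum

sum∞-point : ∀ {n} (g h : Fin (suc n) → ℕ∞) p →
             (∀ u → u ≢ p → g u ≡ h u) → h p ≡ just 0 → sum∞ g ≡ g p ⊕ sum∞ h
sum∞-point = sum-point ⊕-commutativeMonoid

sum∞-zero : ∀ n → sum∞ {n} (λ _ → just 0) ≡ just 0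
sum∞-zero zero    = refl
sum∞-zero (suc n) = cong (just 0 ⊕_) (sum∞-zero n)

sum∞-just : ∀ {n} (h : Fin n → ℕ) → sum∞ (just ∘ h) ≡ just (sumF h)
sum∞-just {zero}  h = refl
sum∞-just {suc n} h = cong (just (h Fin.zero) ⊕_) (sum∞-just (h ∘ Fin.suc))

sum∞-finite : ∀ {n} (g : Fin n → ℕ∞) {c} → sum∞ g ≡ just c → ∀ u → Finite (g u)
sum∞-finite {suc n} g e u with ⊕-just⁻¹ (g Fin.zero) _ e
sum∞-finite {suc n} g e Fin.zero    | a , _ , ga , _ = a , ga
sum∞-finite {suc n} g e (Fin.suc u) | _ , _ , _ , rest , _ = sum∞-finite (g ∘ Fin.suc) rest u

-- Statuses and the update rule

data Status : Set where
  s1 s2 s3 s4 s5 : Status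

status : ℕ → ℕ → Status
status zero          zero          = s5
status zero          (suc zero)    = s4
status zero          (suc (suc _)) = s3
status (suc zero)    _             = s2
status (suc (suc _)) _             = s1

-- combine a b is the new status of a parent of status a after a child of status b is
-- attached below it, or nothing if the child stays undominated or the edge is not independent.
combine : Status → Status → Maybe Status
combine s1 s3 = just s1
combine s1 s4 = just s1
combine s1 s5 = just s1
combine s2 s3 = just s2
combine s2 s4 = just s2
combine s3 s1 = just s3
combine s3 s2 = just s3
combine s3 s3 = just s3
combine s4 s1 = just s3
combine s4 s2 = just s3
combine s5 s1 = just s3
combine s4 s3 = just s4
combine s5 s2 = just s4
combine s5 s3 = just s5
combine _  _  = nothing

-- ny is the neighbour sum of the child before its parent, of value x, is added.
CanAttach : ℕ → ℕ → ℕ → Set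
CanAttach x y ny = (y ≡ 0 → 2 ≤ ny + x) × (0 < y → 0 < x → ⊥)

private
  2≰0 : ¬ 2 ≤ 0
  2≰0 ()

  2≰1 : ¬ 2 ≤ 1
  2≰1 (s≤s ())

  2≤2+ : ∀ n → 2 ≤ 2 + n
  2≤2+ _ = s≤s (s≤s z≤n)

combine-status : ∀ x y nx ny → x ≤ 2 → y ≤ 2 → CanAttach x y ny →
                 combine (status x nx) (status y ny) ≡ just (status x (nx + y))
combine-status _ (suc (suc (suc _))) _ _ _ (s≤s (s≤s ())) _
combine-status (suc (suc (suc _))) _ _ _ (s≤s (s≤s ())) _ _
combine-status (suc _) (suc _) _ _ _ _ (_ , indep) = ⊥-elim (indep (s≤s z≤n) (s≤s z≤n))
combine-status zero          zero _ zero       _ _ (dom , _) = ⊥-elim (2≰0 (dom refl))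
combine-status zero          zero _ (suc zero) _ _ (dom , _) = ⊥-elim (2≰1 (dom refl))
combine-status (suc zero)    zero _ zero       _ _ (dom , _) = ⊥-elim (2≰1 (dom refl))
combine-status zero          zero zero                (suc (suc _)) _ _ _ = refl
combine-status zero          zero (suc zero)          (suc (suc _)) _ _ _ = refl
combine-status zero          zero (suc (suc _))       (suc (suc _)) _ _ _ = refl
combine-status zero          (suc zero) zero          _ _ _ _ = refl
combine-status zero          (suc zero) (suc zero)    _ _ _ _ = refl
combine-status zero          (suc zero) (suc (suc _)) _ _ _ _ = refl
combine-status zero          (suc (suc zero)) zero          _ _ _ _ = refl
combine-status zero          (suc (suc zero)) (suc zero)    _ _ _ _ = refl
combine-status zero          (suc (suc zero)) (suc (suc _)) _ _ _ _ = refl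
combine-status (suc zero)       zero _ (suc zero)    _ _ _ = refl
combine-status (suc zero)       zero _ (suc (suc _)) _ _ _ = refl
combine-status (suc (suc zero)) zero _ zero          _ _ _ = refl
combine-status (suc (suc zero)) zero _ (suc zero)    _ _ _ = refl
combine-status (suc (suc zero)) zero _ (suc (suc _)) _ _ _ = refl

combine-status⁻¹ : ∀ x y nx ny {t} → x ≤ 2 → y ≤ 2 →
                   combine (status x nx) (status y ny) ≡ just t →
                   status x (nx + y) ≡ t × CanAttach x y ny
combine-status⁻¹ _ (suc (suc (suc _))) _ _ _ (s≤s (s≤s ())) _
combine-status⁻¹ (suc (suc (suc _))) _ _ _ (s≤s (s≤s ())) _ _
combine-status⁻¹ zero zero zero          (suc (suc _)) _ _ refl = refl , (λ _ → 2≤2+ _) , λ ()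
combine-status⁻¹ zero zero (suc zero)    (suc (suc _)) _ _ refl = refl , (λ _ → 2≤2+ _) , λ ()
combine-status⁻¹ zero zero (suc (suc _)) (suc (suc _)) _ _ refl = refl , (λ _ → 2≤2+ _) , λ ()
combine-status⁻¹ zero (suc zero) zero          _ _ _ refl = refl , (λ ()) , λ _ ()
combine-status⁻¹ zero (suc zero) (suc zero)    _ _ _ refl = refl , (λ ()) , λ _ ()
combine-status⁻¹ zero (suc zero) (suc (suc _)) _ _ _ refl = refl , (λ ()) , λ _ ()
combine-status⁻¹ zero (suc (suc zero)) zero          _ _ _ refl = refl , (λ ()) , λ _ ()
combine-status⁻¹ zero (suc (suc zero)) (suc zero)    _ _ _ refl = refl , (λ ()) , λ _ ()
combine-status⁻¹ zero (suc (suc zero)) (suc (suc _)) _ _ _ refl = refl , (λ ()) , λ _ ()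
combine-status⁻¹ (suc zero) zero _ (suc zero)    _ _ refl = refl , (λ _ → 2≤2+ _) , λ ()
combine-status⁻¹ (suc zero) zero _ (suc (suc _)) _ _ refl = refl , (λ _ → 2≤2+ _) , λ ()
combine-status⁻¹ (suc (suc zero)) zero _ zero          _ _ refl = refl , (λ _ → 2≤2+ _) , λ ()
combine-status⁻¹ (suc (suc zero)) zero _ (suc zero)    _ _ refl = refl , (λ _ → 2≤2+ _) , λ ()
combine-status⁻¹ (suc (suc zero)) zero _ (suc (suc _)) _ _ refl = refl , (λ _ → 2≤2+ _) , λ ()
combine-status⁻¹ zero zero zero          zero       _ _ ()
combine-status⁻¹ zero zero zero          (suc zero) _ _ ()
combine-status⁻¹ zero zero (suc zero)    zero       _ _ ()
combine-status⁻¹ zero zero (suc zero)    (suc zero) _ _ ()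
combine-status⁻¹ zero zero (suc (suc _)) zero       _ _ ()
combine-status⁻¹ zero zero (suc (suc _)) (suc zero) _ _ ()
combine-status⁻¹ (suc zero) zero _ zero _ _ ()
combine-status⁻¹ (suc zero)       (suc zero)       _ _ _ _ ()
combine-status⁻¹ (suc zero)       (suc (suc zero)) _ _ _ _ ()
combine-status⁻¹ (suc (suc zero)) (suc zero)       _ _ _ _ ()
combine-status⁻¹ (suc (suc zero)) (suc (suc zero)) _ _ _ _ ()

entry : Row → Status → ℕ∞
entry r s1 = l1 r
entry r s2 = l2 r
entry r s3 = l3 r
entry r s4 = l4 r
entry r s5 = l5 r

joinCost : Row → Row → Status × Status → ℕ∞
joinCost K J (a , b) = entry K a ⊕ entry J b

sources : Status → List⁺ (Status × Status)
sources s1 = (s1 , s3) ∷ (s1 , s4) ∷ (s1 , s5) ∷ []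
sources s2 = (s2 , s3) ∷ (s2 , s4) ∷ []
sources s3 = (s3 , s1) ∷ (s3 , s2) ∷ (s3 , s3) ∷ (s4 , s1) ∷ (s4 , s2) ∷ (s5 , s1) ∷ []
sources s4 = (s4 , s3) ∷ (s5 , s2) ∷ []
sources s5 = (s5 , s3) ∷ []

updateRow-⨅ : ∀ K J t → entry (updateRow K J) t ≡ ⨅ (joinCost K J) (sources t)
updateRow-⨅ K J s1 = refl
updateRow-⨅ K J s2 = refl
updateRow-⨅ K J s3 = refl
updateRow-⨅ K J s4 = refl
updateRow-⨅ K J s5 = refl

combine⇒sources : ∀ {a b t} → combine a b ≡ just t → (a , b) ∈ toList (sources t)
combine⇒sources {s1} {s3} refl = here refl
combine⇒sources {s1} {s4} refl = there (here refl)
combine⇒sources {s1} {s5} refl = there (there (here refl))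
combine⇒sources {s2} {s3} refl = here refl
combine⇒sources {s2} {s4} refl = there (here refl)
combine⇒sources {s3} {s1} refl = here refl
combine⇒sources {s3} {s2} refl = there (here refl)
combine⇒sources {s3} {s3} refl = there (there (here refl))
combine⇒sources {s4} {s1} refl = there (there (there (here refl)))
combine⇒sources {s4} {s2} refl = there (there (there (there (here refl))))
combine⇒sources {s5} {s1} refl = there (there (there (there (there (here refl)))))
combine⇒sources {s4} {s3} refl = here refl
combine⇒sources {s5} {s2} refl = there (here refl)
combine⇒sources {s5} {s3} refl = here refl

sources⇒combine : ∀ {a b} t → (a , b) ∈ toList (sources t) → combine a b ≡ just t
sources⇒combine s1 (here refl)                 = refl
sources⇒combine s1 (there (here refl))         = refl
sources⇒combine s1 (there (there (here refl))) = refl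
sources⇒combine s2 (here refl)                 = refl
sources⇒combine s2 (there (here refl))         = refl
sources⇒combine s3 (here refl)                 = refl
sources⇒combine s3 (there (here refl))         = refl
sources⇒combine s3 (there (there (here refl))) = refl
sources⇒combine s3 (there (there (there (here refl))))                 = refl
sources⇒combine s3 (there (there (there (there (here refl)))))         = refl
sources⇒combine s3 (there (there (there (there (there (here refl)))))) = refl
sources⇒combine s4 (here refl)                 = refl
sources⇒combine s4 (there (here refl))         = refl
sources⇒combine s5 (here refl)                 = refl

updateRow-≼ : ∀ K J {a b t} → combine a b ≡ just t →
              entry (updateRow K J) t ≼ entry K a ⊕ entry J b
updateRow-≼ K J {t = t} ab↦t =
  subst (_≼ _) (sym (updateRow-⨅ K J t)) (⨅-≼ (joinCost K J) (sources t) (combine⇒sources ab↦t))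

updateRow-attained : ∀ K J t {c} → entry (updateRow K J) t ≡ just c →
                     ∃ λ a → ∃ λ b → combine a b ≡ just t × entry K a ⊕ entry J b ≡ just c
updateRow-attained K J t e
  with (a , b) , ab∈ , cost ← ⨅-attained (joinCost K J) (sources t) (trans (sym (updateRow-⨅ K J t)) e)
  = a , b , sources⇒combine t ab∈ , cost

Good : Row → Set
Good r = Finite (l1 r) × (Finite (l3 r) ⊎ Finite (l5 r))

updateRow-good : ∀ K J → Good K → Good J → Good (updateRow K J)
updateRow-good K J (k1 , k3∨k5) (j1 , j3∨j5) = l1-finite j3∨j5 , inj₁ (l3-finite k3∨k5)
  where
  via : ∀ a b {t} → combine a b ≡ just t → Finite (entry K a) → Finite (entry J b) →
        Finite (entry (updateRow K J) t)
  via a b ab↦t Ka Jb = ≼-finite (updateRow-≼ K J ab↦t) (⊕-finite Ka Jb)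
  l1-finite : Finite (l3 J) ⊎ Finite (l5 J) → Finite (l1 (updateRow K J))
  l1-finite (inj₁ j3) = via s1 s3 refl k1 j3
  l1-finite (inj₂ j5) = via s1 s5 refl k1 j5
  l3-finite : Finite (l3 K) ⊎ Finite (l5 K) → Finite (l3 (updateRow K J))
  l3-finite (inj₁ k3) = via s3 s1 refl k3 j1
  l3-finite (inj₂ k5) = via s5 s1 refl k5 j1

topStatuses : List⁺ Status
topStatuses = s1 ∷ s2 ∷ s3 ∷ []

answer : Row → ℕ∞
answer L = ⨅ (entry L) topStatuses

Top : Status → Set
Top t = t ∈ toList topStatuses

status-top : ∀ x n → x ≤ 2 → (x ≡ 0 → 2 ≤ n) → Top (status x n)
status-top zero zero          _ dom = ⊥-elim (2≰0 (dom refl))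
status-top zero (suc zero)    _ dom = ⊥-elim (2≰1 (dom refl))
status-top zero (suc (suc _)) _ _   = there (there (here refl))
status-top (suc zero)    _ _ _ = there (here refl)
status-top (suc (suc _)) _ _ _ = here refl

top-dominated : ∀ n → Top (status 0 n) → 2 ≤ n
top-dominated (suc (suc n)) _ = 2≤2+ n
top-dominated zero       (there (there (there ())))
top-dominated (suc zero) (there (there (there ())))

statusValue : Status → ℕ
statusValue s1 = 2
statusValue s2 = 1
statusValue _  = 0

statusValue≤2 : ∀ t → statusValue t ≤ 2
statusValue≤2 s1 = s≤s (s≤s z≤n)
statusValue≤2 s2 = s≤s z≤n
statusValue≤2 s3 = z≤n
statusValue≤2 s4 = z≤n
statusValue≤2 s5 = z≤n

initRow-status : ∀ x → x ≤ 2 → entry initRow (status x 0) ≡ just x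
initRow-status zero             _ = refl
initRow-status (suc zero)       _ = refl
initRow-status (suc (suc zero)) _ = refl
initRow-status (suc (suc (suc _))) (s≤s (s≤s ()))

initRow-finite : ∀ t → Finite (entry initRow t) →
                 entry initRow t ≡ just (statusValue t) × status (statusValue t) 0 ≡ t
initRow-finite s1 _ = refl , refl
initRow-finite s2 _ = refl , refl
initRow-finite s5 _ = refl , refl
initRow-finite s3 (_ , ())
initRow-finite s4 (_ , ())

-- The forest of processed edges

module FatherForest (m : ℕ) (fa : Fin (suc m) → Fin (suc m))
                    (fa-up : ∀ i → toℕ i < m → toℕ i < toℕ (fa i)) where

  V : Set
  V = Fin (suc m)

  hangs : ℕ → V → V → Bool
  hangs j u v = does (toℕ u <? j) ∧ does (fa u ≟ v)

  linked : ℕ → V → V → Bool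
  linked j u v = hangs j u v ∨ hangs j v u

  nb : ℕ → (V → ℕ) → V → ℕ
  nb j f v = sumF (λ u → if linked j v u then f u else 0)

  hangs⇒father : ∀ {j u v} → hangs j u v ≡ true → toℕ u < j × fa u ≡ v
  hangs⇒father {j} {u} {v} h with ∧-true⁻¹ h
  ... | u<j , fu≡v = does⇒ (toℕ u <? j) u<j , does⇒ (fa u ≟ v) fu≡v

  hangs-father : ∀ {j u} → toℕ u < j → hangs j u (fa u) ≡ true
  hangs-father {j} {u} u<j rewrite dec-true (toℕ u <? j) u<j | dec-true (fa u ≟ fa u) refl = refl

  hangs-unprocessed : ∀ {j u} v → j ≤ toℕ u → hangs j u v ≡ false
  hangs-unprocessed {j} {u} v j≤u rewrite dec-false (toℕ u <? j) (ℕ.≤⇒≯ j≤u) = refl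

  hangs-irrefl : ∀ v → hangs m v v ≡ false
  hangs-irrefl v with fa v ≟ v
  ... | no  _    = ∧-zeroʳ _
  ... | yes fv≡v = trans (∧-identityʳ _)
                     (dec-false (toℕ v <? m) λ v<m → ℕ.<-irrefl (cong toℕ (sym fv≡v)) (fa-up v v<m))

  -- nbrSum fatherGraph f is definitionally nb m f.
  fatherGraph : Graph (suc m)
  fatherGraph = record
    { Adj    = linked m
    ; sym    = λ u v → ∨-comm (hangs m u v) (hangs m v u)
    ; irrefl = λ v → cong (λ b → b ∨ b) (hangs-irrefl v) }

  statusAt : ℕ → (V → ℕ) → V → Status
  statusAt j f v = status (f v) (nb j f v)

  record Realises (j : ℕ) (s : V → Status) (f : V → ℕ) : Set where
    field
      bounded     : ∀ v → f v ≤ 2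
      independent : ∀ u → toℕ u < j → 0 < f u → 0 < f (fa u) → ⊥
      dominated   : ∀ v → toℕ v < j → f v ≡ 0 → 2 ≤ nb j f v
      rootStatus  : ∀ v → j ≤ toℕ v → statusAt j f v ≡ s v

  rootTerm : ℕ → (V → Row) → (V → Status) → V → ℕ∞
  rootTerm j l s x = if does (j ≤? toℕ x) then entry (l x) (s x) else just 0

  tableCost : ℕ → (V → Row) → (V → Status) → ℕ∞
  tableCost j l s = sum∞ (rootTerm j l s)

  record TableInvariant (j : ℕ) (l : V → Row) : Set where
    field
      cost-≼-weight : ∀ {s f} → Realises j s f → tableCost j l s ≼ just (weight f)
      cost-attained : ∀ {s c} → tableCost j l s ≡ just c → ∃ λ f → Realises j s f × weight f ≡ c
      rows-good     : ∀ x → j ≤ toℕ x → Good (l x)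

  nb-initial : ∀ f v → nb 0 f v ≡ 0
  nb-initial f v = sumF-zero isolated
    where
    isolated : ∀ u → (if linked 0 v u then f u else 0) ≡ 0
    isolated u rewrite hangs-unprocessed {0} {u} v z≤n | hangs-unprocessed {0} {v} u z≤n = refl

  invariant-initial : TableInvariant 0 (λ _ → initRow)
  invariant-initial = record
    { cost-≼-weight = lower
    ; cost-attained = attained
    ; rows-good     = λ _ _ → (2 , refl) , inj₂ (0 , refl) }
    where
    rootTerm-initial : ∀ s x → rootTerm 0 (λ _ → initRow) s x ≡ entry initRow (s x)
    rootTerm-initial s x rewrite dec-true (0 ≤? toℕ x) z≤n = refl
    lower : ∀ {s f} → Realises 0 s f → tableCost 0 (λ _ → initRow) s ≼ just (weight f)
    lower {s} {f} R = subst (_≼ just (weight f)) (sym cost) (ℕ.≤-refl)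
      where
      open Realises R
      cost : tableCost 0 (λ _ → initRow) s ≡ just (weight f)
      cost = trans (ℕ∞Σ.sum-cong-≗ termwise) (sum∞-just f)
        where
        termwise : ∀ x → rootTerm 0 (λ _ → initRow) s x ≡ just (f x)
        termwise x = begin
          rootTerm 0 (λ _ → initRow) s x           ≡⟨ rootTerm-initial s x ⟩
          entry initRow (s x)                      ≡⟨ cong (entry initRow) (sym (rootStatus x z≤n)) ⟩
          entry initRow (status (f x) (nb 0 f x))  ≡⟨ cong (entry initRow ∘ status (f x)) (nb-initial f x) ⟩
          entry initRow (status (f x) 0)           ≡⟨ initRow-status (f x) (bounded x) ⟩
          just (f x)                               ∎
          where open ≡-Reasoning
    attained : ∀ {s c} → tableCost 0 (λ _ → initRow) s ≡ just c →
               ∃ λ f → Realises 0 s f × weight f ≡ c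
    attained {s} {c} e = statusValue ∘ s , realises , just-injective weight≡
      where
      finite : ∀ x → entry initRow (s x) ≡ just (statusValue (s x)) × status (statusValue (s x)) 0 ≡ s x
      finite x = initRow-finite (s x)
        (subst Finite (rootTerm-initial s x) (sum∞-finite (rootTerm 0 (λ _ → initRow) s) e x))
      realises : Realises 0 s (statusValue ∘ s)
      realises = record
        { bounded     = λ v → statusValue≤2 (s v)
        ; independent = λ _ ()
        ; dominated   = λ _ ()
        ; rootStatus  = λ v _ → trans (cong (status (statusValue (s v))) (nb-initial (statusValue ∘ s) v))
                                      (proj₂ (finite v)) }
      weight≡ : just (weight (statusValue ∘ s)) ≡ just c
      weight≡ = trans (sym (sum∞-just (statusValue ∘ s)))
                 (trans (ℕ∞Σ.sum-cong-≗ (λ x → sym (trans (rootTerm-initial s x) (proj₁ (finite x))))) e)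

  nb-extend : ∀ j j′ f v p → (∀ u → u ≢ p → linked j′ v u ≡ linked j v u) →
              linked j v p ≡ false → linked j′ v p ≡ true → nb j′ f v ≡ nb j f v + f p
  nb-extend j j′ f v p same old new = begin
    nb j′ f v                                      ≡⟨ sumF-point _ _ p termwise (cong term old) ⟩
    (if linked j′ v p then f p else 0) + nb j f v  ≡⟨ cong (λ b → term b + nb j f v) new ⟩
    f p + nb j f v                                 ≡⟨ ℕ.+-comm (f p) _ ⟩
    nb j f v + f p                                 ∎
    where
    open ≡-Reasoning
    term : Bool → ℕ
    term b = if b then f p else 0
    termwise : ∀ u → u ≢ p → (if linked j′ v u then f u else 0) ≡ (if linked j v u then f u else 0)
    termwise u u≢p = cong (λ b → if b then f u else 0) (same u u≢p)

  below-suc : ∀ {v w : V} → toℕ v < suc (toℕ w) → toℕ v < toℕ w ⊎ v ≡ w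
  below-suc v<1+w with ℕ.m<1+n⇒m<n∨m≡n v<1+w
  ... | inj₁ v<w = inj₁ v<w
  ... | inj₂ v≡w = inj₂ (toℕ-injective v≡w)

  above : ∀ {v w : V} → toℕ w ≤ toℕ v → v ≡ w ⊎ suc (toℕ w) ≤ toℕ v
  above w≤v with ℕ.m≤n⇒m<n∨m≡n w≤v
  ... | inj₁ w<v = inj₂ w<v
  ... | inj₂ w≡v = inj₁ (toℕ-injective (sym w≡v))

  module Step (vⱼ : V) (vⱼ<m : toℕ vⱼ < m) where

    j : ℕ
    j = toℕ vⱼ

    vₖ : V
    vₖ = fa vⱼ

    j<k : j < toℕ vₖ
    j<k = fa-up vⱼ vⱼ<m

    vₖ≢vⱼ : vₖ ≢ vⱼ
    vₖ≢vⱼ vₖ≡vⱼ = ℕ.<-irrefl (cong toℕ (sym vₖ≡vⱼ)) j<k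

    vⱼ≢vₖ : vⱼ ≢ vₖ
    vⱼ≢vₖ = vₖ≢vⱼ ∘ sym

    <-suc-≢ : ∀ {x} → x ≢ vⱼ → does (toℕ x <? suc j) ≡ does (toℕ x <? j)
    <-suc-≢ {x} x≢vⱼ = does-cong (toℕ x <? suc j) (toℕ x <? j) shrink ℕ.m<n⇒m<1+n
      where
      shrink : toℕ x < suc j → toℕ x < j
      shrink x<1+j with below-suc x<1+j
      ... | inj₁ x<j  = x<j
      ... | inj₂ x≡vⱼ = ⊥-elim (x≢vⱼ x≡vⱼ)

    ≤-suc-≢ : ∀ {x} → x ≢ vⱼ → does (suc j ≤? toℕ x) ≡ does (j ≤? toℕ x)
    ≤-suc-≢ {x} x≢vⱼ = does-cong (suc j ≤? toℕ x) (j ≤? toℕ x) ℕ.<⇒≤ grow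
      where
      grow : j ≤ toℕ x → suc j ≤ toℕ x
      grow j≤x with above j≤x
      ... | inj₁ x≡vⱼ = ⊥-elim (x≢vⱼ x≡vⱼ)
      ... | inj₂ j<x  = j<x

    hangs-step-≢ᵘ : ∀ {u} v → u ≢ vⱼ → hangs (suc j) u v ≡ hangs j u v
    hangs-step-≢ᵘ {u} v u≢vⱼ = cong (_∧ does (fa u ≟ v)) (<-suc-≢ u≢vⱼ)

    hangs-step-≢ᵛ : ∀ u {v} → v ≢ vₖ → hangs (suc j) u v ≡ hangs j u v
    hangs-step-≢ᵛ u {v} v≢vₖ with u ≟ vⱼ
    ... | no  u≢vⱼ = hangs-step-≢ᵘ v u≢vⱼ
    ... | yes refl = begin
      does (toℕ vⱼ <? suc j) ∧ does (vₖ ≟ v)  ≡⟨ cong (_ ∧_) (dec-false (vₖ ≟ v) (v≢vₖ ∘ sym)) ⟩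
      does (toℕ vⱼ <? suc j) ∧ false          ≡⟨ ∧-zeroʳ _ ⟩
      false                                   ≡⟨ sym (hangs-unprocessed v ℕ.≤-refl) ⟩
      hangs j vⱼ v                            ∎
      where open ≡-Reasoning

    hangs-step-new : hangs (suc j) vⱼ vₖ ≡ true
    hangs-step-new = hangs-father (ℕ.n<1+n j)

    nb-father : ∀ f → nb (suc j) f vₖ ≡ nb j f vₖ + f vⱼ
    nb-father f = nb-extend j (suc j) f vₖ vⱼ
      (λ u u≢vⱼ → cong₂ _∨_ (hangs-step-≢ᵘ u vₖ≢vⱼ) (hangs-step-≢ᵘ vₖ u≢vⱼ))
      (cong₂ _∨_ (hangs-unprocessed vⱼ (ℕ.<⇒≤ j<k)) (hangs-unprocessed vₖ ℕ.≤-refl))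
      (trans (cong (hangs (suc j) vₖ vⱼ ∨_) hangs-step-new) (∨-zeroʳ _))

    nb-child : ∀ f → nb (suc j) f vⱼ ≡ nb j f vⱼ + f vₖ
    nb-child f = nb-extend j (suc j) f vⱼ vₖ
      (λ u u≢vₖ → cong₂ _∨_ (hangs-step-≢ᵛ vⱼ u≢vₖ) (hangs-step-≢ᵛ u vⱼ≢vₖ))
      (cong₂ _∨_ (hangs-unprocessed vₖ ℕ.≤-refl) (hangs-unprocessed vⱼ (ℕ.<⇒≤ j<k)))
      (cong (_∨ hangs (suc j) vₖ vⱼ) hangs-step-new)

    nb-other : ∀ f {v} → v ≢ vₖ → v ≢ vⱼ → nb (suc j) f v ≡ nb j f v
    nb-other f {v} v≢vₖ v≢vⱼ = sumF-cong λ u →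
      cong (λ b → if b then f u else 0) (cong₂ _∨_ (hangs-step-≢ᵘ u v≢vⱼ) (hangs-step-≢ᵛ u v≢vₖ))

    module _ (l : V → Row) (c : ℕ) where

      l′ : V → Row
      l′ = proj₁ (step fa (l , c) vⱼ)

      step-father : l′ vₖ ≡ updateRow (l vₖ) (l vⱼ)
      step-father with vₖ ≟ vₖ
      ... | yes _   = refl
      ... | no  vₖ≢vₖ = ⊥-elim (vₖ≢vₖ refl)

      step-other : ∀ {x} → x ≢ vₖ → l′ x ≡ l x
      step-other {x} x≢vₖ with x ≟ vₖ
      ... | yes x≡vₖ = ⊥-elim (x≢vₖ x≡vₖ)
      ... | no  _   = refl

    -- Before vⱼ is attached, vₖ and vⱼ are both roots, with the statuses a and b.
    detach : (V → Status) → Status → Status → V → Status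
    detach s a b x = if does (x ≟ vₖ) then a else if does (x ≟ vⱼ) then b else s x

    detach-father : ∀ s a b → detach s a b vₖ ≡ a
    detach-father s a b rewrite dec-true (vₖ ≟ vₖ) refl = refl

    detach-child : ∀ s a b → detach s a b vⱼ ≡ b
    detach-child s a b rewrite dec-false (vⱼ ≟ vₖ) vⱼ≢vₖ | dec-true (vⱼ ≟ vⱼ) refl = refl

    detach-other : ∀ s a b {x} → x ≢ vₖ → x ≢ vⱼ → detach s a b x ≡ s x
    detach-other s a b {x} x≢vₖ x≢vⱼ rewrite dec-false (x ≟ vₖ) x≢vₖ | dec-false (x ≟ vⱼ) x≢vⱼ = refl

    -- The roots other than vₖ and vⱼ contribute the same to the costs before and after the step.
    restTerm : (V → Row) → (V → Status) → V → ℕ∞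
    restTerm l s x = if does (x ≟ vₖ) then just 0 else rootTerm (suc j) l s x

    restTerm-father : ∀ l s → restTerm l s vₖ ≡ just 0
    restTerm-father l s rewrite dec-true (vₖ ≟ vₖ) refl = refl

    cost-after : ∀ l c s →
                 tableCost (suc j) (l′ l c) s ≡ entry (updateRow (l vₖ) (l vⱼ)) (s vₖ) ⊕ sum∞ (restTerm l s)
    cost-after l c s =
      trans (sum∞-point (rootTerm (suc j) (l′ l c) s) (restTerm l s) vₖ off (restTerm-father l s))
            (cong (_⊕ sum∞ (restTerm l s)) at-father)
      where
      at-father : rootTerm (suc j) (l′ l c) s vₖ ≡ entry (updateRow (l vₖ) (l vⱼ)) (s vₖ)
      at-father rewrite dec-true (suc j ≤? toℕ vₖ) j<k | step-father l c = refl
      off : ∀ x → x ≢ vₖ → rootTerm (suc j) (l′ l c) s x ≡ restTerm l s x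
      off x x≢vₖ rewrite dec-false (x ≟ vₖ) x≢vₖ | step-other l c x≢vₖ = refl

    cost-before : ∀ l s a b →
                  tableCost j l (detach s a b) ≡ (entry (l vₖ) a ⊕ entry (l vⱼ) b) ⊕ sum∞ (restTerm l s)
    cost-before l s a b = begin
      sum∞ g
        ≡⟨ sum∞-point g g₋ vₖ (λ x x≢vₖ → sym (g₋-other x≢vₖ)) g₋-father ⟩
      g vₖ ⊕ sum∞ g₋
        ≡⟨ cong (g vₖ ⊕_) (sum∞-point g₋ (restTerm l s) vⱼ off restTerm-child) ⟩
      g vₖ ⊕ (g₋ vⱼ ⊕ sum∞ (restTerm l s))
        ≡⟨ cong₂ (λ x y → x ⊕ (y ⊕ _)) at-father at-child ⟩
      entry (l vₖ) a ⊕ (entry (l vⱼ) b ⊕ sum∞ (restTerm l s))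
        ≡⟨ sym (⊕-assoc _ _ _) ⟩
      (entry (l vₖ) a ⊕ entry (l vⱼ) b) ⊕ sum∞ (restTerm l s)
        ∎
      where
      open ≡-Reasoning
      s′ = detach s a b
      g = rootTerm j l s′
      g₋ = λ x → if does (x ≟ vₖ) then just 0 else g x
      g₋-father : g₋ vₖ ≡ just 0
      g₋-father rewrite dec-true (vₖ ≟ vₖ) refl = refl
      g₋-other : ∀ {x} → x ≢ vₖ → g₋ x ≡ g x
      g₋-other {x} x≢vₖ rewrite dec-false (x ≟ vₖ) x≢vₖ = refl
      at-father : g vₖ ≡ entry (l vₖ) a
      at-father rewrite dec-true (j ≤? toℕ vₖ) (ℕ.<⇒≤ j<k) | detach-father s a b = refl
      at-child : g₋ vⱼ ≡ entry (l vⱼ) b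
      at-child rewrite g₋-other vⱼ≢vₖ | dec-true (j ≤? toℕ vⱼ) ℕ.≤-refl | detach-child s a b = refl
      restTerm-child : restTerm l s vⱼ ≡ just 0
      restTerm-child rewrite dec-false (vⱼ ≟ vₖ) vⱼ≢vₖ | dec-false (suc j ≤? toℕ vⱼ) (ℕ.<-irrefl refl)
        = refl
      off : ∀ x → x ≢ vⱼ → g₋ x ≡ restTerm l s x
      off x x≢vⱼ with x ≟ vₖ
      ... | yes _   = refl
      ... | no  _ rewrite ≤-suc-≢ x≢vⱼ | dec-false (x ≟ vⱼ) x≢vⱼ = refl

    below⇒≢father : ∀ {v} → toℕ v < j → v ≢ vₖ
    below⇒≢father v<j refl = ℕ.<-asym v<j j<k

    below⇒≢child : ∀ {v} → toℕ v < j → v ≢ vⱼ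
    below⇒≢child v<j refl = ℕ.<-irrefl refl v<j

    above⇒≢child : ∀ {v} → suc j ≤ toℕ v → v ≢ vⱼ
    above⇒≢child j<v refl = ℕ.<-irrefl refl j<v

    detach-realises : ∀ {s f} → Realises (suc j) s f →
                      combine (statusAt j f vₖ) (statusAt j f vⱼ) ≡ just (s vₖ) ×
                      Realises j (detach s (statusAt j f vₖ) (statusAt j f vⱼ)) f
    detach-realises {s} {f} R = attached , record
      { bounded     = bounded
      ; independent = λ u u<j → independent u (ℕ.m<n⇒m<1+n u<j)
      ; dominated   = dominated′
      ; rootStatus  = rootStatus′ }
      where
      open Realises R
      a = statusAt j f vₖ
      b = statusAt j f vⱼ
      can : CanAttach (f vₖ) (f vⱼ) (nb j f vⱼ)
      can = (λ fvⱼ≡0 → subst (2 ≤_) (nb-child f) (dominated vⱼ (ℕ.n<1+n j) fvⱼ≡0))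
          , independent vⱼ (ℕ.n<1+n j)
      attached : combine a b ≡ just (s vₖ)
      attached = begin
        combine a b                              ≡⟨ combine-status _ _ _ _ (bounded vₖ) (bounded vⱼ) can ⟩
        just (status (f vₖ) (nb j f vₖ + f vⱼ))  ≡⟨ cong (just ∘ status (f vₖ)) (sym (nb-father f)) ⟩
        just (statusAt (suc j) f vₖ)             ≡⟨ cong just (rootStatus vₖ j<k) ⟩
        just (s vₖ)                              ∎
        where open ≡-Reasoning
      dominated′ : ∀ v → toℕ v < j → f v ≡ 0 → 2 ≤ nb j f v
      dominated′ v v<j fv≡0 = subst (2 ≤_) (nb-other f (below⇒≢father v<j) (below⇒≢child v<j))
                                (dominated v (ℕ.m<n⇒m<1+n v<j) fv≡0)
      rootStatus′ : ∀ v → j ≤ toℕ v → statusAt j f v ≡ detach s a b v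
      rootStatus′ v j≤v with above j≤v | toSum (v ≟ vₖ)
      ... | inj₁ refl | _        = sym (detach-child s a b)
      ... | inj₂ _    | inj₁ refl = sym (detach-father s a b)
      ... | inj₂ j<v  | inj₂ v≢vₖ  = begin
        statusAt j f v        ≡⟨ cong (status (f v)) (sym (nb-other f v≢vₖ (above⇒≢child j<v))) ⟩
        statusAt (suc j) f v  ≡⟨ rootStatus v j<v ⟩
        s v                   ≡⟨ sym (detach-other s a b v≢vₖ (above⇒≢child j<v)) ⟩
        detach s a b v        ∎
        where open ≡-Reasoning

    attach-realises : ∀ {s f a b} → combine a b ≡ just (s vₖ) → Realises j (detach s a b) f →
                      Realises (suc j) s f
    attach-realises {s} {f} {a} {b} ab↦sₖ R = record
      { bounded     = bounded
      ; independent = independent′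
      ; dominated   = dominated′
      ; rootStatus  = rootStatus′ }
      where
      open Realises R
      attached : status (f vₖ) (nb j f vₖ + f vⱼ) ≡ s vₖ × CanAttach (f vₖ) (f vⱼ) (nb j f vⱼ)
      attached = combine-status⁻¹ (f vₖ) (f vⱼ) _ _ (bounded vₖ) (bounded vⱼ)
        (subst₂ (λ x y → combine x y ≡ just (s vₖ))
          (sym (trans (rootStatus vₖ (ℕ.<⇒≤ j<k)) (detach-father s a b)))
          (sym (trans (rootStatus vⱼ ℕ.≤-refl) (detach-child s a b)))
          ab↦sₖ)
      independent′ : ∀ u → toℕ u < suc j → 0 < f u → 0 < f (fa u) → ⊥
      independent′ u u<1+j with below-suc u<1+j
      ... | inj₁ u<j = independent u u<j
      ... | inj₂ refl = proj₂ (proj₂ attached)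
      dominated′ : ∀ v → toℕ v < suc j → f v ≡ 0 → 2 ≤ nb (suc j) f v
      dominated′ v v<1+j fv≡0 with below-suc v<1+j
      ... | inj₁ v<j = subst (2 ≤_) (sym (nb-other f (below⇒≢father v<j) (below⇒≢child v<j)))
                         (dominated v v<j fv≡0)
      ... | inj₂ refl = subst (2 ≤_) (sym (nb-child f)) (proj₁ (proj₂ attached) fv≡0)
      rootStatus′ : ∀ v → suc j ≤ toℕ v → statusAt (suc j) f v ≡ s v
      rootStatus′ v j<v with toSum (v ≟ vₖ)
      ... | inj₁ refl = trans (cong (status (f vₖ)) (nb-father f)) (proj₁ attached)
      ... | inj₂ v≢vₖ  = begin
        statusAt (suc j) f v  ≡⟨ cong (status (f v)) (nb-other f v≢vₖ (above⇒≢child j<v)) ⟩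
        statusAt j f v        ≡⟨ rootStatus v (ℕ.<⇒≤ j<v) ⟩
        detach s a b v        ≡⟨ detach-other s a b v≢vₖ (above⇒≢child j<v) ⟩
        s v                   ∎
        where open ≡-Reasoning

    step-invariant : ∀ {l} c → TableInvariant j l → TableInvariant (suc j) (l′ l c)
    step-invariant {l} c I = record
      { cost-≼-weight = lower
      ; cost-attained = attained
      ; rows-good     = good }
      where
      open TableInvariant I
      lower : ∀ {s f} → Realises (suc j) s f → tableCost (suc j) (l′ l c) s ≼ just (weight f)
      lower {s} {f} R with detach-realises R
      ... | attached , R′ =
        subst (_≼ just (weight f)) (sym (cost-after l c s))
          (≼-trans (⊕-mono-≼ (updateRow-≼ (l vₖ) (l vⱼ) attached) (≼-refl (sum∞ (restTerm l s))))
                   (subst (_≼ just (weight f)) (cost-before l s _ _) (cost-≼-weight R′)))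
      attained : ∀ {s w} → tableCost (suc j) (l′ l c) s ≡ just w →
                 ∃ λ f → Realises (suc j) s f × weight f ≡ w
      attained {s} e
        with c₁ , c₂ , at-k , rest , c₁+c₂≡w ← ⊕-just⁻¹ _ _ (trans (sym (cost-after l c s)) e)
        with a , b , ab↦sₖ , joined ← updateRow-attained (l vₖ) (l vⱼ) (s vₖ) at-k
        with f , R′ , weight≡ ← cost-attained
               (trans (cost-before l s a b) (trans (cong₂ _⊕_ joined rest) (cong just c₁+c₂≡w)))
        = f , attach-realises ab↦sₖ R′ , weight≡
      good : ∀ x → suc j ≤ toℕ x → Good (l′ l c x)
      good x j<x with toSum (x ≟ vₖ)
      ... | inj₁ refl = subst Good (sym (step-father l c))
                          (updateRow-good (l vₖ) (l vⱼ) (rows-good vₖ (ℕ.<⇒≤ j<k)) (rows-good vⱼ ℕ.≤-refl))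
      ... | inj₂ x≢vₖ  = subst Good (sym (step-other l c x≢vₖ)) (rows-good x (ℕ.<⇒≤ j<x))

  loop-invariant : ∀ n (g : Fin n → V) j {l} c → (∀ i → toℕ (g i) ≡ j + toℕ i) → j + n ≤ m →
                   TableInvariant j l →
                   TableInvariant (j + n) (proj₁ (foldl (step fa) (l , c) (tabulate g)))
  loop-invariant zero    g j c _ _ I = subst (λ i → TableInvariant i _) (sym (ℕ.+-identityʳ j)) I
  loop-invariant (suc n) g j {l} c g≡ j+n≤m I =
    subst (λ i → TableInvariant i (proj₁ (foldl (step fa) (l , c) (tabulate g)))) (sym (ℕ.+-suc j n))
      (loop-invariant n (g ∘ Fin.suc) (suc j) {proj₁ (step fa (l , c) (g Fin.zero))} (c + 7)
        (λ i → trans (g≡ (Fin.suc i)) (ℕ.+-suc j (toℕ i))) (subst (_≤ m) (ℕ.+-suc j n) j+n≤m) first)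
    where
    g₀≡j : toℕ (g Fin.zero) ≡ j
    g₀≡j = trans (g≡ Fin.zero) (ℕ.+-identityʳ j)
    g₀<m : toℕ (g Fin.zero) < m
    g₀<m = subst (_< m) (sym g₀≡j) (ℕ.<-≤-trans (ℕ.m<m+n j (s≤s z≤n)) j+n≤m)
    first : TableInvariant (suc j) (proj₁ (step fa (l , c) (g Fin.zero)))
    first = subst (λ i → TableInvariant (suc i) _) g₀≡j
      (Step.step-invariant (g Fin.zero) g₀<m c (subst (λ i → TableInvariant i l) (sym g₀≡j) I))

  vₙ : V
  vₙ = fromℕ m

  unprocessed⇒vₙ : ∀ {x} → m ≤ toℕ x → x ≡ vₙ
  unprocessed⇒vₙ {x} m≤x = toℕ-injective (trans (ℕ.≤-antisym (toℕ≤pred[n] x) m≤x) (sym (toℕ-fromℕ m)))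

  tableCost-final : ∀ l s → tableCost m l s ≡ entry (l vₙ) (s vₙ)
  tableCost-final l s = begin
    sum∞ (rootTerm m l s)                             ≡⟨ sum∞-point _ (λ _ → just 0) vₙ only-vₙ refl ⟩
    rootTerm m l s vₙ ⊕ sum∞ {suc m} (λ _ → just 0)  ≡⟨ cong₂ _⊕_ at-vₙ (sum∞-zero (suc m)) ⟩
    entry (l vₙ) (s vₙ) ⊕ just 0                    ≡⟨ ⊕-identityʳ _ ⟩
    entry (l vₙ) (s vₙ)                             ∎
    where
    open ≡-Reasoning
    at-vₙ : rootTerm m l s vₙ ≡ entry (l vₙ) (s vₙ)
    at-vₙ rewrite dec-true (m ≤? toℕ vₙ) (ℕ.≤-reflexive (sym (toℕ-fromℕ m))) = refl
    only-vₙ : ∀ x → x ≢ vₙ → rootTerm m l s x ≡ just 0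
    only-vₙ x x≢vₙ rewrite dec-false (m ≤? toℕ x) (x≢vₙ ∘ unprocessed⇒vₙ) = refl

  linked⇒hangs : ∀ {u v} → linked m u v ≡ true → (toℕ u < m × fa u ≡ v) ⊎ (toℕ v < m × fa v ≡ u)
  linked⇒hangs {u} {v} uv with hangs m u v in huv
  ... | true  = inj₁ (hangs⇒father huv)
  ... | false = inj₂ (hangs⇒father uv)

  realises⇒IR2DF : ∀ {s f} → Realises m s f → Top (s vₙ) → IsIR2DF fatherGraph f
  realises⇒IR2DF {s} {f} R top = (bounded , dominated′) , independent′
    where
    open Realises R
    dominated′ : ∀ v → f v ≡ 0 → 2 ≤ nb m f v
    dominated′ v fv≡0 with toSum (toℕ v <? m)
    ... | inj₁ v<m = dominated v v<m fv≡0
    ... | inj₂ v≮m with unprocessed⇒vₙ (ℕ.≮⇒≥ v≮m)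
    ... | refl = top-dominated (nb m f vₙ) (subst Top (sym status≡) top)
      where
      status≡ : status 0 (nb m f vₙ) ≡ s vₙ
      status≡ = trans (cong (λ x → status x (nb m f vₙ)) (sym fv≡0)) (rootStatus vₙ (ℕ.≮⇒≥ v≮m))
    independent′ : ∀ u v → Adjacent fatherGraph u v → 0 < f u → 0 < f v → ⊥
    independent′ u v uv with linked⇒hangs uv
    ... | inj₁ (u<m , refl) = independent u u<m
    ... | inj₂ (v<m , refl) = λ fu fv → independent v v<m fv fu

  IR2DF⇒realises : ∀ {f} → IsIR2DF fatherGraph f → Realises m (statusAt m f) f × Top (statusAt m f vₙ)
  IR2DF⇒realises {f} ((bounded , dominated) , independent) =
    R , status-top (f vₙ) _ (bounded vₙ) (dominated vₙ)
    where
    R : Realises m (statusAt m f) f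
    R = record
      { bounded     = bounded
      ; independent = λ u u<m → independent u (fa u) (cong (_∨ hangs m (fa u) u) (hangs-father u<m))
      ; dominated   = λ v _ → dominated v
      ; rootStatus  = λ _ _ → refl }

  answer-correct : ∀ {l} → TableInvariant m l →
                   ∃ λ r → answer (l vₙ) ≡ just r × IsIndepRoman2DomNumber fatherGraph r
  answer-correct {l} I = r , answer≡r , attained , minimal
    where
    open TableInvariant I
    finite : Finite (answer (l vₙ))
    finite = ≼-finite (⨅-≼ (entry (l vₙ)) topStatuses (here refl))
                      (proj₁ (rows-good vₙ (ℕ.≤-reflexive (sym (toℕ-fromℕ m)))))
    r = proj₁ finite
    answer≡r = proj₂ finite
    attained : Σ (V → ℕ) λ f → IsIR2DF fatherGraph f × weight f ≡ r
    attained with t , t-top , entry≡r ← ⨅-attained (entry (l vₙ)) topStatuses answer≡r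
             with f , R , weight≡r ← cost-attained {s = λ _ → t} (trans (tableCost-final l (λ _ → t)) entry≡r)
      = f , realises⇒IR2DF R t-top , weight≡r
    minimal : ∀ f → IsIR2DF fatherGraph f → r ≤ weight f
    minimal f ir with R , top ← IR2DF⇒realises ir =
      subst (_≼ just (weight f)) answer≡r
        (≼-trans (⨅-≼ (entry (l vₙ)) topStatuses top)
                 (subst (_≼ just (weight f)) (tableCost-final l (statusAt m f)) (cost-≼-weight R)))

-- Relabelling

injective⇒surjective : ∀ {n} {σ : Fin n → Fin n} → Injective _≡_ _≡_ σ → ∀ x → ∃ λ p → σ p ≡ x
injective⇒surjective {suc n} {σ} σ-inj x with any? (λ p → σ p ≟ x)
... | yes hit = hit
... | no miss = ⊥-elim (ℕ.<-irrefl refl (injective⇒≤ squeeze-injective))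
  where
  squeeze : Fin (suc n) → Fin n
  squeeze p = punchOut {i = x} {j = σ p} (λ x≡σp → miss (p , sym x≡σp))
  squeeze-injective : Injective _≡_ _≡_ squeeze
  squeeze-injective {p} {q} e = σ-inj (punchOut-injective (λ x≡σp → miss (p , sym x≡σp))
                                                         (λ x≡σq → miss (q , sym x≡σq)) e)

injective⇒permutation : ∀ {n} {σ : Fin n → Fin n} → Injective _≡_ _≡_ σ → Permutation n n
injective⇒permutation {σ = σ} σ-inj =
  Perm.permutation σ (proj₁ ∘ surj) (proj₂ ∘ surj) (λ p → σ-inj (proj₂ (surj (σ p))))
  where surj = injective⇒surjective σ-inj

weight-permute : ∀ {n} (π : Permutation n n) g → weight g ≡ weight (g ∘ (π ⟨$⟩ʳ_))
weight-permute π g = trans (sumF≡sum g) (trans (ℕΣ.sum-permute g π) (sym (sumF≡sum (g ∘ (π ⟨$⟩ʳ_)))))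

module _ {n} {G H : Graph n} (π : Permutation n n)
         (adj : ∀ p q → Adj G (π ⟨$⟩ʳ p) (π ⟨$⟩ʳ q) ≡ Adj H p q) where

  nbrSum-relabel : ∀ g p → nbrSum G g (π ⟨$⟩ʳ p) ≡ nbrSum H (g ∘ (π ⟨$⟩ʳ_)) p
  nbrSum-relabel g p =
    trans (weight-permute π _) (sumF-cong λ q → cong (λ b → if b then g (π ⟨$⟩ʳ q) else 0) (adj p q))

  IR2DF-relabel : ∀ {g} → IsIR2DF G g → IsIR2DF H (g ∘ (π ⟨$⟩ʳ_))
  IR2DF-relabel {g} ((bounded , dominated) , independent) =
    (bounded ∘ (π ⟨$⟩ʳ_) , λ p gp≡0 → subst (2 ≤_) (nbrSum-relabel g p) (dominated (π ⟨$⟩ʳ p) gp≡0)) ,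
    λ p q pq → independent (π ⟨$⟩ʳ p) (π ⟨$⟩ʳ q) (trans (adj p q) pq)

IR2DF-number-relabel : ∀ {n} {G H : Graph n} (π : Permutation n n) →
                       (∀ p q → Adj G (π ⟨$⟩ʳ p) (π ⟨$⟩ʳ q) ≡ Adj H p q) →
                       ∀ {r} → IsIndepRoman2DomNumber H r → IsIndepRoman2DomNumber G r
IR2DF-number-relabel {G = G} {H} π adj {r} ((f , f-ir , weight≡r) , minimal) =
  (f ∘ (π ⟨$⟩ˡ_) , IR2DF-relabel {G = H} {H = G} (Perm.flip π) adj⁻¹ f-ir , weight≡) ,
  λ g g-ir → subst (r ≤_) (sym (weight-permute π g)) (minimal _ (IR2DF-relabel {G = G} {H = H} π adj g-ir))
  where
  adj⁻¹ : ∀ u v → Adj H (π ⟨$⟩ˡ u) (π ⟨$⟩ˡ v) ≡ Adj G u v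
  adj⁻¹ u v = trans (sym (adj _ _)) (cong₂ (Adj G) (inverseʳ π) (inverseʳ π))
  weight≡ : weight (f ∘ (π ⟨$⟩ˡ_)) ≡ r
  weight≡ = trans (weight-permute π (f ∘ (π ⟨$⟩ˡ_)))
                  (trans (sumF-cong λ p → cong f (inverseˡ π {p})) weight≡r)

-- The algorithm

run : ∀ {m} → (Fin (suc m) → Fin (suc m)) → State (suc m)
run {m} fa = foldl (step fa) ((λ _ → initRow) , 5 * suc m) (tabulate {n = m} inject₁)

algorithm-value : ∀ {m} (fa : Fin (suc m) → Fin (suc m)) →
                  proj₁ (algorithm fa) ≡ answer (proj₁ (run fa) (fromℕ m))
algorithm-value {zero}  fa = refl
algorithm-value {suc m} fa = refl

loop-steps : ∀ {n} (fa : Fin n → Fin n) l c xs → proj₂ (foldl (step fa) (l , c) xs) ≡ c + 7 * length xs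
loop-steps fa l c []       = sym (ℕ.+-identityʳ c)
loop-steps fa l c (x ∷ xs) = begin
  proj₂ (foldl (step fa) (step fa (l , c) x) xs)  ≡⟨ loop-steps fa _ (c + 7) xs ⟩
  c + 7 + 7 * length xs                           ≡⟨ ℕ.+-assoc c 7 _ ⟩
  c + (7 + 7 * length xs)                         ≡⟨ cong (c +_) (sym (ℕ.*-suc 7 (length xs))) ⟩
  c + 7 * suc (length xs)                         ∎
  where open ≡-Reasoning

algorithm-steps : ∀ {m} (fa : Fin (suc m) → Fin (suc m)) → proj₂ (algorithm fa) ≤ 15 * suc m
algorithm-steps {zero}  fa = s≤s z≤n
algorithm-steps {suc m} fa = begin
  proj₂ (run fa) + 3           ≡⟨ cong (_+ 3) (loop-steps fa (λ _ → initRow) (5 * n) loop) ⟩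
  5 * n + 7 * length loop + 3  ≡⟨ cong (λ L → 5 * n + 7 * L + 3) (length-tabulate {n = suc m} inject₁) ⟩
  5 * n + 7 * suc m + 3        ≤⟨ ℕ.+-mono-≤ (ℕ.+-monoʳ-≤ (5 * n) (ℕ.*-monoʳ-≤ 7 (ℕ.n≤1+n (suc m))))
                                              (ℕ.*-monoʳ-≤ 3 (s≤s {0} {suc m} z≤n)) ⟩
  5 * n + 7 * n + 3 * n        ≡⟨ sym (trans (ℕ.*-distribʳ-+ n 12 3) (cong (_+ 3 * n) (ℕ.*-distribʳ-+ n 5 7))) ⟩
  15 * n                       ∎
  where
  n = suc (suc m)
  loop = tabulate {n = suc m} inject₁
  open ℕ.≤-Reasoning

module TreeOrdering {m} (G : Graph (suc m)) (ord fa : Fin (suc m) → Fin (suc m))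
                    (TO : IsTreeOrdering G ord) (FM : IsFatherMap G ord fa) where

  fa-up : ∀ i → toℕ i < m → toℕ i < toℕ (fa i)
  fa-up i i<m = proj₁ (FM i i<m)

  open FatherForest m fa fa-up

  later-neighbour-hangs : ∀ {p q} → toℕ p < toℕ q → Adjacent G (ord p) (ord q) → hangs m p q ≡ true
  later-neighbour-hangs {p} {q} p<q pq =
    subst (λ v → hangs m p v ≡ true) father≡q (hangs-father p<m)
    where
    p<m : toℕ p < m
    p<m = ℕ.<-≤-trans p<q (toℕ≤pred[n] q)
    unique : ∀ k → toℕ p < toℕ k → Adjacent G (ord p) (ord k) → k ≡ proj₁ (proj₂ TO p p<m)
    unique = proj₂ (proj₂ (proj₂ TO p p<m))
    father≡q : fa p ≡ q
    father≡q = trans (unique (fa p) (fa-up p p<m) (proj₂ (FM p p<m))) (sym (unique q p<q pq))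

  adjacent⇒linked : ∀ p q → Adjacent G (ord p) (ord q) → linked m p q ≡ true
  adjacent⇒linked p q pq with ℕ.<-cmp (toℕ p) (toℕ q)
  ... | tri< p<q _ _ = cong (_∨ hangs m q p) (later-neighbour-hangs p<q pq)
  ... | tri> _ _ q<p = trans (cong (hangs m p q ∨_) (later-neighbour-hangs q<p (trans (Graph.sym G _ _) pq)))
                             (∨-zeroʳ _)
  ... | tri≈ _ p≡q _ with refl ← toℕ-injective {i = p} {q} p≡q
                     with () ← trans (sym pq) (irrefl G (ord p))

  linked⇒adjacent : ∀ p q → linked m p q ≡ true → Adjacent G (ord p) (ord q)
  linked⇒adjacent p q pq with linked⇒hangs pq
  ... | inj₁ (p<m , refl) = proj₂ (FM p p<m)
  ... | inj₂ (q<m , refl) = trans (Graph.sym G _ _) (proj₂ (FM q q<m))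

  algorithm-correct : Σ ℕ λ r → proj₁ (algorithm fa) ≡ just r × IsIndepRoman2DomNumber G r
  algorithm-correct =
    let r , answer≡r , number = answer-correct loop-done in
    r , trans (algorithm-value fa) answer≡r ,
    IR2DF-number-relabel {G = G} {H = fatherGraph} (injective⇒permutation (proj₁ TO))
      (λ p q → Bool-≡ (adjacent⇒linked p q) (linked⇒adjacent p q)) number
    where
    loop-done : TableInvariant m (proj₁ (run fa))
    loop-done = loop-invariant m inject₁ 0 (5 * suc m) toℕ-inject₁ ℕ.≤-refl invariant-initial

theorem7 : Σ ℕ λ c →
    ∀ (m : ℕ) (G : Graph (suc m)) (ord fa : Fin (suc m) → Fin (suc m)) →
      IsTree G → IsTreeOrdering G ord → IsFatherMap G ord fa →
      (Σ ℕ λ r → proj₁ (algorithm fa) ≡ just r × IsIndepRoman2DomNumber G r)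
      × proj₂ (algorithm fa) ≤ c * suc m
theorem7 = 15 , λ m G ord fa _ TO FM →
  TreeOrdering.algorithm-correct G ord fa TO FM , algorithm-steps fa
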